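{- For every $\phi\in\mathcal{L}_{FO}$, every state $s\in[\![\phi]\!]$ and every $\alpha\in\mathcal{L}^m_K$ such that $FV(\phi)\cup FV(\alpha)\subseteq\mathbf{p}$, we have $([\![\phi]\!],s)\models\alpha$ if and only if $s\models_{FO}\tau(\phi,\alpha)$.
   Context: Agents and variables: $Ag=\{a_1,\dots,a_m\}$ is a finite set of agents. $\mathcal{V}$ is a set of variables, each typed with the group of agents that can observe it, written $x_G$ with $G\subseteq Ag$; $\mathbf{p}\subseteq\mathcal{V}$ is a nonempty set of program variables. $\mathrm{obs}_a=\{x_G\mid a\in G\}$, $\mathrm{nonobs}_a=\{x_G\mid a\notin G\}$. $\mathsf{D}$ is a domain; $\mathcal{L}_{QF}$ is a quantifier-free first-order language over $\mathcal{V}$ with a fixed interpretation over $\mathsf{D}$. States: a state is a function $s$ from $\mathsf{dom}(s)\subseteq\mathcal{V}$ to $\mathsf{D}$; $\mathcal{U}$ is the set of all states; $s[x\mapsto c]$ is $s$ updated at $x$; $W[x\mapsto c]=\{s[x\mapsto c]\mid s\in W\}$. $s\approx_a s'$ iff $s(x)=s'(x)$ for all $x\in(\mathsf{dom}(s)\cup\mathsf{dom}(s'))\cap\mathrm{obs}_a$. First-order logic $\mathcal{L}_{FO}$: $\phi ::= \pi\mid\phi\wedge\phi\mid\neg\phi\mid\forall x_G\cdot\phi$ with $\pi\in\mathcal{L}_{QF}$, and standard satisfaction $s\models_{FO}\phi$ (with $s\models_{FO}\forall x_G\cdot\phi$ iff $s[x_G\mapsto c]\models_{FO}\phi$ for all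 $c\in\mathsf{D}$); $[\![\phi]\!]=\{s\in\mathcal{U}\mid s\models_{FO}\phi\}$; $\forall\mathbf{x}$ for a finite set/vector $\mathbf{x}$ quantifies over all its variables. Logic $\mathcal{L}^m_K$: $\alpha ::= \pi \mid \alpha\wedge\alpha \mid \neg\alpha \mid K_{a}\alpha \mid [\alpha']\alpha \mid \forall x_G\cdot\alpha$. Semantics at $(W,s)$, $s\in W\subseteq\mathcal{U}$: $(W,s)\models\pi$ iff $\pi$ true at $s$; connectives as usual; $(W,s)\models K_a\alpha$ iff $(W,s')\models\alpha$ for all $s'\in W$ with $s'\approx_a s$; $(W,s)\models[\beta]\alpha$ iff $(W,s)\models\beta$ implies $(W_{|\beta},s)\models\alpha$, where $W_{|\beta}=\{s'\in W\mid (W,s')\models\beta\}$; for $x_G\notin\mathsf{dom}(W)$, $(W,s)\models\forall x_G\cdot\alpha$ iff for all $c\in\mathsf{D}$, $(\bigcup_{d\in\mathsf{D}}W[x_G\mapsto d],s[x_G\mapsto c])\models\alpha$. Translation $\tau$ (for $\phi\in\mathcal{L}_{FO}$): $\tau(\phi,\pi)=\pi$; $\tau(\phi,\neg\alpha)=\neg\tau(\phi,\alpha)$; $\tau(\phi,\alpha_1\circ\alpha_2)=\tau(\phi,\alpha_1)\circ\tau(\phi,\alpha_2)$ for $\circ\in\{\wedge,\vee\}$; $\tau(\phi,K_a\alpha)=\forall\mathbf{n}\cdot(\phi\rightarrow\tau(\phi,\alpha))$ where $\mathbf{n}=\mathrm{nonobs}_a\cap(FV(\alpha)\cup FV(\phi))$;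 $\tau(\phi,[\beta]\alpha)=\tau(\phi,\beta)\rightarrow\tau(\phi\wedge\tau(\phi,\beta),\alpha)$; $\tau(\phi,\forall x_G\cdot\alpha)=\forall x_G\cdot\tau(\phi,\alpha)$. -}

module Defs where

open import Data.Nat using (ℕ; zero; suc)
open import Data.Fin using (Fin; zero; suc)
open import Data.Fin.Subset using (Subset) renaming (_∈_ to _∈ₛ_; _∉_ to _∉ₛ_)
open import Data.Fin.Subset.Properties using () renaming (_∈?_ to _∈ₛ?_)
open import Data.Maybe using (Maybe; just; nothing; maybe′; Is-just)
open import Data.List using (List; []; _∷_; _++_; filter; foldr)
open import Data.List.Membership.Propositional using (_∈_)
open import Data.Product using (Σ; ∃-syntax; _×_; _,_)
open import Data.Sum using (_⊎_)
open import Data.Empty using (⊥)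
open import Data.Unit using (⊤)
open import Relation.Nullary using (¬_; ¬?; does)
open import Relation.Binary.PropositionalEquality using (_≡_)
open import Relation.Binary.Definitions using (DecidableEquality)
open import Data.Bool using (if_then_else_)

-- The fixed setting: agents Ag = Fin m, variables x_G typed by the group
-- G ⊆ Ag that observes them, a domain D, and a first-order signature
-- (function and relation symbols with a fixed interpretation over D)
-- giving the quantifier-free language L_QF.

record Setting : Set₁ where
  field
    m         : ℕ
    Var       : Set
    _≟V_      : DecidableEquality Var
    group     : Var → Subset m
    D         : Set
    Fun       : Set
    funArity  : Fun → ℕ
    funInterp : (f : Fun) → (Fin (funArity f) → D) → D
    Rel       : Set
    relArity  : Rel → ℕ
    relInterp : (r : Rel) → (Fin (relArity r) → D) → Set

module Logic (S : Setting) where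
  open Setting S

  Agent : Set
  Agent = Fin m

  NonObs : Agent → Var → Set
  NonObs a x = a ∉ₛ group x

  data Term : Set where
    var : Var → Term
    fun : (f : Fun) → (Fin (funArity f) → Term) → Term

  data QF : Set where
    rel  : (r : Rel) → (Fin (relArity r) → Term) → QF
    _≐_  : Term → Term → QF
    ¬q_  : QF → QF
    _∧q_ : QF → QF → QF
    _∨q_ : QF → QF → QF

  concatFin : ∀ {A : Set} n → (Fin n → List A) → List A
  concatFin zero    f = []
  concatFin (suc n) f = f zero ++ concatFin n (λ i → f (suc i))

  fvT : Term → List Var
  fvT (var x)    = x ∷ []
  fvT (fun f ts) = concatFin (funArity f) (λ i → fvT (ts i))

  fvQF : QF → List Var
  fvQF (rel r ts) = concatFin (relArity r) (λ i → fvT (ts i))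
  fvQF (t ≐ u)    = fvT t ++ fvT u
  fvQF (¬q q)     = fvQF q
  fvQF (q ∧q q′)  = fvQF q ++ fvQF q′
  fvQF (q ∨q q′)  = fvQF q ++ fvQF q′

  remove : Var → List Var → List Var
  remove x = filter (λ y → ¬? (y ≟V x))

  State : Set
  State = Var → Maybe D

  _[_↦_] : State → Var → D → State
  (s [ x ↦ c ]) y = if does (y ≟V x) then just c else s y

  _≗_ : State → State → Set
  s ≗ t = ∀ y → s y ≡ t y

  _≈[_]_ : State → Agent → State → Set
  s ≈[ a ] s′ = ∀ x → a ∈ₛ group x → (Is-just (s x) ⊎ Is-just (s′ x)) → s x ≡ s′ x

  HasDom : (Var → Set) → State → Set
  HasDom P s = ∀ x → (P x → Is-just (s x)) × (Is-just (s x) → P x)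

  -- Fixed interpretation of L_QF (an atom whose terms are not all
  -- defined at s is false; this never matters in the theorem below)

  seqFin : ∀ n → (Fin n → Maybe D) → Maybe (Fin n → D)
  seqFin zero    f = just (λ ())
  seqFin (suc n) f with f zero | seqFin n (λ i → f (suc i))
  ... | just d  | just g  = just (λ { zero → d ; (suc i) → g i })
  ... | _       | _       = nothing

  evalT : State → Term → Maybe D
  evalT s (var x)    = s x
  evalT s (fun f ts) =
    maybe′ (λ v → just (funInterp f v)) nothing (seqFin (funArity f) (λ i → evalT s (ts i)))

  eqM : Maybe D → Maybe D → Set
  eqM (just a) (just b) = a ≡ b
  eqM _        _        = ⊥

  holdsQF : State → QF → Set
  holdsQF s (rel r ts) = maybe′ (relInterp r) ⊥ (seqFin (relArity r) (λ i → evalT s (ts i)))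
  holdsQF s (t ≐ u)    = eqM (evalT s t) (evalT s u)
  holdsQF s (¬q q)     = ¬ holdsQF s q
  holdsQF s (q ∧q q′)  = holdsQF s q × holdsQF s q′
  holdsQF s (q ∨q q′)  = holdsQF s q ⊎ holdsQF s q′

  infixr 4 _⇒_
  infixr 5 _∧f_
  data FO : Set where
    qf   : QF → FO
    _∧f_ : FO → FO → FO
    ¬f_  : FO → FO
    _⇒_  : FO → FO → FO
    ∀′   : Var → FO → FO

  ∀* : List Var → FO → FO
  ∀* xs φ = foldr ∀′ φ xs

  fvFO : FO → List Var
  fvFO (qf π)   = fvQF π
  fvFO (φ ∧f ψ)  = fvFO φ ++ fvFO ψ
  fvFO (¬f φ)   = fvFO φ
  fvFO (φ ⇒ ψ)  = fvFO φ ++ fvFO ψ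
  fvFO (∀′ x φ) = remove x (fvFO φ)

  _⊨FO_ : State → FO → Set
  s ⊨FO qf π   = holdsQF s π
  s ⊨FO (φ ∧f ψ) = (s ⊨FO φ) × (s ⊨FO ψ)
  s ⊨FO (¬f φ)  = ¬ (s ⊨FO φ)
  s ⊨FO (φ ⇒ ψ) = s ⊨FO φ → s ⊨FO ψ
  s ⊨FO ∀′ x φ  = ∀ c → (s [ x ↦ c ]) ⊨FO φ

  ⟦_⟧_ : FO → (Var → Set) → State → Set
  (⟦ φ ⟧ P) s = HasDom P s × (s ⊨FO φ)

  data Form : Set where
    atom : QF → Form
    _∧K_ : Form → Form → Form
    ¬K_  : Form → Form
    K    : Agent → Form → Form
    [_]_ : Form → Form → Form
    ∀K   : Var → Form → Form

  fvK : Form → List Var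
  fvK (atom π)  = fvQF π
  fvK (α ∧K β)  = fvK α ++ fvK β
  fvK (¬K α)    = fvK α
  fvK (K a α)   = fvK α
  fvK ([ β ] α) = fvK β ++ fvK α
  fvK (∀K x α)  = remove x (fvK α)

  StateSet : Set₁
  StateSet = State → Set

  ⋃upd : StateSet → Var → StateSet
  ⋃upd W x t = ∃[ d ] ∃[ s ] (W s × (t ≗ (s [ x ↦ d ])))

  Sat : StateSet → State → Form → Set
  Sat W s (atom π)  = holdsQF s π
  Sat W s (α ∧K β)  = Sat W s α × Sat W s β
  Sat W s (¬K α)    = ¬ Sat W s α
  Sat W s (K a α)   = ∀ s′ → W s′ → s′ ≈[ a ] s → Sat W s′ α
  Sat W s ([ β ] α) = Sat W s β → Sat (λ s′ → W s′ × Sat W s′ β) s α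
  Sat W s (∀K x α)  = ∀ c → Sat (⋃upd W x) (s [ x ↦ c ]) α

  -- The paper defines (W,s) ⊨ ∀x·α only when x ∉ dom(W).  Starting from
  -- W with domain P, this side condition holds at every quantifier
  -- exactly when the following predicate holds.
  BoundFresh : (Var → Set) → Form → Set
  BoundFresh P (atom π)  = ⊤
  BoundFresh P (α ∧K β)  = BoundFresh P α × BoundFresh P β
  BoundFresh P (¬K α)    = BoundFresh P α
  BoundFresh P (K a α)   = BoundFresh P α
  BoundFresh P ([ β ] α) = BoundFresh P β × BoundFresh P α
  BoundFresh P (∀K x α)  = ¬ P x × BoundFresh (λ y → P y ⊎ y ≡ x) α

  nonobsFilter : Agent → List Var → List Var
  nonobsFilter a = filter (λ y → ¬? (a ∈ₛ? group y))

  τ : FO → Form → FO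
  τ φ (atom π)  = qf π
  τ φ (α ∧K β)  = τ φ α ∧f τ φ β
  τ φ (¬K α)    = ¬f τ φ α
  τ φ (K a α)   = ∀* (nonobsFilter a (fvK α ++ fvFO φ)) (φ ⇒ τ φ α)
  τ φ ([ β ] α) = τ φ β ⇒ τ (φ ∧f τ φ β) α
  τ φ (∀K x α)  = ∀′ x (τ φ α)

  _⊆_ : List Var → (Var → Set) → Set
  xs ⊆ P = ∀ {x} → x ∈ xs → P x

{-# OPTIONS --safe #-}
-- The claim is proved by induction on α for an arbitrary domain P and formula ψ
-- with free variables in P, since both change along the way: ∀x enlarges the
-- domain by x, and [β] strengthens ψ to ψ ∧ τ(ψ,β).  Each modal case is a fact
-- about the state set [[ψ]] over P.  The states of [[ψ]] that agent a cannot
-- tell apart from s are exactly the states of [[ψ]] obtained from s by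
-- reassigning the variables a does not observe, which is what the quantifier
-- block of τ(ψ, K_a α) ranges over.  The states of [[ψ]] satisfying β form
-- [[ψ ∧ τ(ψ,β)]] by induction.  And since x is fresh and not free in ψ, the
-- union of the [[ψ]][x ↦ d] is [[ψ]] over the domain P ∪ {x}.

module Submission where

open import Defs
open import Data.Product using (Σ)
open import Function.Bundles using (_⇔_)

open import Data.Bool using (if_then_else_)
open import Data.Empty using (⊥-elim)
open import Data.Nat using (zero; suc)
open import Data.Fin using (Fin; zero; suc)
open import Data.Fin.Subset using () renaming (_∈_ to _∈ₛ_)
open import Data.Fin.Subset.Properties using () renaming (_∈?_ to _∈ₛ?_)
open import Data.List using (List; []; _∷_; _++_)
open import Data.List.Membership.Propositional using (_∈_; _∉_)
open import Data.List.Membership.Propositional.Properties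
  using (∈-++⁺ˡ; ∈-++⁺ʳ; ∈-++⁻; ∈-filter⁺; ∈-filter⁻)
open import Data.List.Relation.Unary.Any using (here; there)
open import Data.Maybe using (Maybe; just; nothing; maybe′; Is-just)
open import Data.Maybe.Relation.Unary.Any using () renaming (just to is-just)
open import Data.Product using (∃-syntax; _×_; _,_; proj₁; proj₂)
open import Data.Product.Function.NonDependent.Propositional using (_×-⇔_)
open import Data.Sum using (_⊎_; inj₁; inj₂) renaming ([_,_] to either)
open import Data.Unit using (tt)
open import Function using (id)
open import Function.Bundles using (mk⇔; module Equivalence)
open import Function.Construct.Identity using (⇔-id)
open import Function.Related.TypeIsomorphisms using (¬-cong-⇔)
open import Relation.Binary.PropositionalEquality
  using (_≡_; _≢_; refl; sym; trans; cong; subst; subst₂)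
open import Relation.Nullary using (¬_; ¬?; does; yes; no)
open import Relation.Nullary.Decidable using (dec-true; dec-false; decidable-stable)
open import Relation.Unary using (_⊆′_; _≐′_)
open import Relation.Unary.Properties using (≐′-sym)

module _ (S : Setting) where
  open Setting S
  open Logic S
  open import Data.List.Membership.DecPropositional _≟V_ using (_∈?_)
  open Equivalence

  Is-just⇒≡just : ∀ {m : Maybe D} → Is-just m → ∃[ d ] m ≡ just d
  Is-just⇒≡just (is-just _) = _ , refl

  ≡just⇒Is-just : ∀ {m : Maybe D} {d} → m ≡ just d → Is-just m
  ≡just⇒Is-just refl = is-just tt

  [↦]-≡ : ∀ s x c → (s [ x ↦ c ]) x ≡ just c
  [↦]-≡ s x c rewrite dec-true (x ≟V x) refl = refl

  [↦]-≢ : ∀ s {x y} c → y ≢ x → (s [ x ↦ c ]) y ≡ s y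
  [↦]-≢ s {x} {y} c y≢x rewrite dec-false (y ≟V x) y≢x = refl

  extend : (Var → Set) → Var → Var → Set
  extend P x y = P y ⊎ y ≡ x

  module _ {P : Var → Set} where

    ++⁺-⊆ : ∀ {xs ys} → xs ⊆ P → ys ⊆ P → (xs ++ ys) ⊆ P
    ++⁺-⊆ {xs} xs⊆P ys⊆P m = either xs⊆P ys⊆P (∈-++⁻ xs m)

    ++⁻ˡ-⊆ : ∀ {xs} ys → (xs ++ ys) ⊆ P → xs ⊆ P
    ++⁻ˡ-⊆ _ h m = h (∈-++⁺ˡ m)

    ++⁻ʳ-⊆ : ∀ xs {ys} → (xs ++ ys) ⊆ P → ys ⊆ P
    ++⁻ʳ-⊆ xs h m = h (∈-++⁺ʳ xs m)

    remove⁺-⊆ : ∀ {x xs} → xs ⊆ extend P x → remove x xs ⊆ P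
    remove⁺-⊆ {x} h m with ∈-filter⁻ (λ z → ¬? (z ≟V x)) m
    ... | m′ , y≢x = either id (λ y≡x → ⊥-elim (y≢x y≡x)) (h m′)

    remove⁻-⊆ : ∀ {x} xs → remove x xs ⊆ P → xs ⊆ extend P x
    remove⁻-⊆ {x} xs h {y} m with y ≟V x
    ... | yes y≡x = inj₂ y≡x
    ... | no y≢x = inj₁ (h (∈-filter⁺ (λ z → ¬? (z ≟V x)) m y≢x))

  fvFO-∀*-⊆ : ∀ {P} xs χ → fvFO χ ⊆ P → fvFO (∀* xs χ) ⊆ P
  fvFO-∀*-⊆ []       χ h = h
  fvFO-∀*-⊆ (x ∷ xs) χ h = remove⁺-⊆ (λ m → inj₁ (fvFO-∀*-⊆ xs χ h m))

  fvFO-τ-⊆ : ∀ {P} ψ α → fvFO ψ ⊆ P → fvK α ⊆ P → fvFO (τ ψ α) ⊆ P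
  fvFO-τ-⊆ ψ (atom π)  hψ hα = hα
  fvFO-τ-⊆ ψ (α ∧K β)  hψ hα =
    ++⁺-⊆ (fvFO-τ-⊆ ψ α hψ (++⁻ˡ-⊆ (fvK β) hα)) (fvFO-τ-⊆ ψ β hψ (++⁻ʳ-⊆ (fvK α) hα))
  fvFO-τ-⊆ ψ (¬K α)    hψ hα = fvFO-τ-⊆ ψ α hψ hα
  fvFO-τ-⊆ ψ (K a α)   hψ hα =
    fvFO-∀*-⊆ (nonobsFilter a (fvK α ++ fvFO ψ)) (ψ ⇒ τ ψ α) (++⁺-⊆ hψ (fvFO-τ-⊆ ψ α hψ hα))
  fvFO-τ-⊆ {P} ψ ([ β ] α) hψ hα =
    ++⁺-⊆ hτβ (fvFO-τ-⊆ (ψ ∧f τ ψ β) α (++⁺-⊆ hψ hτβ) (++⁻ʳ-⊆ (fvK β) hα))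
    where
    hτβ : fvFO (τ ψ β) ⊆ P
    hτβ = fvFO-τ-⊆ ψ β hψ (++⁻ˡ-⊆ (fvK α) hα)
  fvFO-τ-⊆ ψ (∀K x α)  hψ hα =
    remove⁺-⊆ (fvFO-τ-⊆ ψ α (λ m → inj₁ (hψ m)) (remove⁻-⊆ (fvK α) hα))

  Agree : List Var → State → State → Set
  Agree xs s t = xs ⊆ (λ y → s y ≡ t y)

  Agree-sym : ∀ {xs s t} → Agree xs s t → Agree xs t s
  Agree-sym ag m = sym (ag m)

  Agree-off : ∀ {x xs s t} → x ∉ xs → (∀ {y} → y ≢ x → s y ≡ t y) → Agree xs s t
  Agree-off x∉xs off {y} m = off λ { refl → x∉xs m }

  Agree-concatFin : ∀ {s t} n (F : Fin n → List Var) i →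
                    Agree (concatFin n F) s t → Agree (F i) s t
  Agree-concatFin (suc n) F zero    ag = ++⁻ˡ-⊆ (concatFin n (λ j → F (suc j))) ag
  Agree-concatFin (suc n) F (suc i) ag =
    Agree-concatFin n (λ j → F (suc j)) i (++⁻ʳ-⊆ (F zero) ag)

  seqFin-cong : ∀ n {f g : Fin n → Maybe D} → (∀ i → f i ≡ g i) → seqFin n f ≡ seqFin n g
  seqFin-cong zero    eq = refl
  seqFin-cong (suc n) {f} {g} eq
    rewrite eq zero | seqFin-cong n {λ i → f (suc i)} {λ i → g (suc i)} (λ i → eq (suc i)) = refl

  evalT-cong : ∀ {s t} u → Agree (fvT u) s t → evalT s u ≡ evalT t u
  evalT-cong (var x)    ag = ag (here refl)
  evalT-cong (fun f ts) ag = cong (maybe′ (λ v → just (funInterp f v)) nothing)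
    (seqFin-cong (funArity f) (λ i → evalT-cong (ts i) (Agree-concatFin (funArity f) _ i ag)))

  holdsQF-cong : ∀ {s t} q → Agree (fvQF q) s t → holdsQF s q → holdsQF t q
  holdsQF-cong (rel r ts) ag = subst (maybe′ (relInterp r) _)
    (seqFin-cong (relArity r) (λ i → evalT-cong (ts i) (Agree-concatFin (relArity r) _ i ag)))
  holdsQF-cong (u ≐ v)   ag =
    subst₂ eqM (evalT-cong u (++⁻ˡ-⊆ (fvT v) ag)) (evalT-cong v (++⁻ʳ-⊆ (fvT u) ag))
  holdsQF-cong (¬q q)    ag h h′ = h (holdsQF-cong q (Agree-sym ag) h′)
  holdsQF-cong (q ∧q q′) ag (h , h′) =
    holdsQF-cong q (++⁻ˡ-⊆ (fvQF q′) ag) h , holdsQF-cong q′ (++⁻ʳ-⊆ (fvQF q) ag) h′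
  holdsQF-cong (q ∨q q′) ag (inj₁ h) = inj₁ (holdsQF-cong q (++⁻ˡ-⊆ (fvQF q′) ag) h)
  holdsQF-cong (q ∨q q′) ag (inj₂ h) = inj₂ (holdsQF-cong q′ (++⁻ʳ-⊆ (fvQF q) ag) h)

  [↦]-cong : ∀ {s t x} c xs → Agree (remove x xs) s t → Agree xs (s [ x ↦ c ]) (t [ x ↦ c ])
  [↦]-cong {x = x} c xs ag {y} m with y ≟V x
  ... | yes _  = refl
  ... | no y≢x = ag (∈-filter⁺ (λ z → ¬? (z ≟V x)) m y≢x)

  ⊨FO-cong : ∀ {s t} φ → Agree (fvFO φ) s t → s ⊨FO φ → t ⊨FO φ
  ⊨FO-cong (qf π)   ag h = holdsQF-cong π ag h
  ⊨FO-cong (φ ∧f ψ) ag (h , h′) =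
    ⊨FO-cong φ (++⁻ˡ-⊆ (fvFO ψ) ag) h , ⊨FO-cong ψ (++⁻ʳ-⊆ (fvFO φ) ag) h′
  ⊨FO-cong (¬f φ)   ag h h′ = h (⊨FO-cong φ (Agree-sym ag) h′)
  ⊨FO-cong (φ ⇒ ψ)  ag h h′ =
    ⊨FO-cong ψ (++⁻ʳ-⊆ (fvFO φ) ag) (h (⊨FO-cong φ (Agree-sym (++⁻ˡ-⊆ (fvFO ψ) ag)) h′))
  ⊨FO-cong (∀′ x φ) ag h c = ⊨FO-cong φ ([↦]-cong c (fvFO φ) ag) (h c)

  Variant : List Var → State → State → Set
  Variant ns s t = (∀ y → y ∉ ns → t y ≡ s y) × (∀ y → y ∈ ns → Is-just (t y))

  Variant-∷⁻ : ∀ {x ns s t c} → Variant (x ∷ ns) s t → t x ≡ just c → Variant ns (s [ x ↦ c ]) t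
  Variant-∷⁻ {x} {ns} {s} {t} {c} (same , defined) tx≡c = same′ , λ y m → defined y (there m)
    where
    same′ : ∀ y → y ∉ ns → t y ≡ (s [ x ↦ c ]) y
    same′ y y∉ns with y ≟V x
    ... | yes refl = tx≡c
    ... | no y≢x   = same y λ { (here y≡x) → y≢x y≡x ; (there m) → y∉ns m }

  Variant-∷⁺ : ∀ {x ns s t c} → Variant ns (s [ x ↦ c ]) t → Variant (x ∷ ns) s t
  Variant-∷⁺ {x} {ns} {s} {t} {c} (same , defined) = same′ , defined′
    where
    same′ : ∀ y → y ∉ x ∷ ns → t y ≡ s y
    same′ y y∉ = trans (same y (λ m → y∉ (there m))) ([↦]-≢ s c (λ y≡x → y∉ (here y≡x)))
    defined′ : ∀ y → y ∈ x ∷ ns → Is-just (t y)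
    defined′ y (there m) = defined y m
    defined′ y (here refl) with y ∈? ns
    ... | yes m   = defined y m
    ... | no y∉ns = ≡just⇒Is-just (trans (same y y∉ns) ([↦]-≡ s y c))

  ∀*-elim : ∀ ns χ {s t} → s ⊨FO ∀* ns χ → Variant ns s t → t ⊨FO χ
  ∀*-elim []       χ h (same , _) = ⊨FO-cong χ (λ {y} _ → sym (same y λ ())) h
  ∀*-elim (x ∷ ns) χ h v@(_ , defined) with Is-just⇒≡just (defined x (here refl))
  ... | c , tx≡c = ∀*-elim ns χ (h c) (Variant-∷⁻ v tx≡c)

  ∀*-intro : ∀ ns χ {s} → (∀ t → Variant ns s t → t ⊨FO χ) → s ⊨FO ∀* ns χ
  ∀*-intro []       χ {s} h   = h s ((λ _ _ → refl) , λ _ ())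
  ∀*-intro (x ∷ ns) χ     h c = ∀*-intro ns χ λ t v → h t (Variant-∷⁺ v)

  ⋃upd-mono : ∀ {W W′ : StateSet} x → W ⊆′ W′ → ⋃upd W x ⊆′ ⋃upd W′ x
  ⋃upd-mono x W⊆W′ t (d , s , s∈W , t≗) = d , s , W⊆W′ s s∈W , t≗

  Sat-resp-≐′ : ∀ α {W W′ s} → W ≐′ W′ → Sat W s α → Sat W′ s α
  Sat-resp-≐′ (atom π)  W≐W′ h = h
  Sat-resp-≐′ (α ∧K β)  W≐W′ (h , h′) = Sat-resp-≐′ α W≐W′ h , Sat-resp-≐′ β W≐W′ h′
  Sat-resp-≐′ (¬K α)    W≐W′ h h′ = h (Sat-resp-≐′ α (≐′-sym W≐W′) h′)
  Sat-resp-≐′ (K a α)   W≐W′ h s′ s′∈W′ s′≈s =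
    Sat-resp-≐′ α W≐W′ (h s′ (proj₂ W≐W′ s′ s′∈W′) s′≈s)
  Sat-resp-≐′ ([ β ] α) W≐W′ h hβ =
    Sat-resp-≐′ α (restrict W≐W′ , restrict (≐′-sym W≐W′)) (h (Sat-resp-≐′ β (≐′-sym W≐W′) hβ))
    where
    restrict : ∀ {V V′} → V ≐′ V′ → (λ t → V t × Sat V t β) ⊆′ (λ t → V′ t × Sat V′ t β)
    restrict V≐V′ t (t∈V , tβ) = proj₁ V≐V′ t t∈V , Sat-resp-≐′ β V≐V′ tβ
  Sat-resp-≐′ (∀K x α)  W≐W′ h c =
    Sat-resp-≐′ α (⋃upd-mono x (proj₁ W≐W′) , ⋃upd-mono x (proj₂ W≐W′)) (h c)

  HasDom-resp-≗ : ∀ {P s t} → s ≗ t → HasDom P s → HasDom P t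
  HasDom-resp-≗ {P} s≗t dom y =
    subst (λ m → (P y → Is-just m) × (Is-just m → P y)) (s≗t y) (dom y)

  ⟦⟧-resp-≗ : ∀ ψ {P s t} → s ≗ t → (⟦ ψ ⟧ P) s → (⟦ ψ ⟧ P) t
  ⟦⟧-resp-≗ ψ s≗t (dom , sψ) = HasDom-resp-≗ s≗t dom , ⊨FO-cong ψ (λ {y} _ → s≗t y) sψ

  erase : Var → State → State
  erase x s y = if does (y ≟V x) then nothing else s y

  erase-≢ : ∀ s {x y} → y ≢ x → erase x s y ≡ s y
  erase-≢ s {x} {y} y≢x rewrite dec-false (y ≟V x) y≢x = refl

  erase-[↦] : ∀ {s x d} → s x ≡ just d → s ≗ (erase x s [ x ↦ d ])
  erase-[↦] {s} {x} {d} sx≡d y with y ≟V x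
  ... | yes refl = sx≡d
  ... | no _     = refl

  HasDom-[↦] : ∀ {P s x} c → HasDom P s → HasDom (extend P x) (s [ x ↦ c ])
  HasDom-[↦] {x = x} c dom y with y ≟V x
  ... | yes y≡x = (λ _ → is-just tt) , (λ _ → inj₂ y≡x)
  ... | no y≢x  = either (proj₁ (dom y)) (λ y≡x → ⊥-elim (y≢x y≡x))
                , (λ j → inj₁ (proj₂ (dom y) j))

  HasDom-erase : ∀ {P s x} → ¬ P x → HasDom (extend P x) s → HasDom P (erase x s)
  HasDom-erase {x = x} ¬Px dom y with y ≟V x
  ... | yes refl = (λ Py → ⊥-elim (¬Px Py)) , λ ()
  ... | no y≢x   = (λ Py → proj₁ (dom y) (inj₁ Py))
                 , (λ j → either id (λ y≡x → ⊥-elim (y≢x y≡x)) (proj₂ (dom y) j))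

  [↦]-∈⟦⟧ : ∀ {P} ψ {s x} c → ¬ P x → fvFO ψ ⊆ P →
            (⟦ ψ ⟧ P) s → (⟦ ψ ⟧ extend P x) (s [ x ↦ c ])
  [↦]-∈⟦⟧ ψ {s} c ¬Px hψ (dom , sψ) = HasDom-[↦] c dom
    , ⊨FO-cong ψ (Agree-off (λ m → ¬Px (hψ m)) (λ y≢x → sym ([↦]-≢ s c y≢x))) sψ

  erase-∈⟦⟧ : ∀ {P} ψ {s x} → ¬ P x → fvFO ψ ⊆ P →
              (⟦ ψ ⟧ extend P x) s → (⟦ ψ ⟧ P) (erase x s)
  erase-∈⟦⟧ ψ {s} ¬Px hψ (dom , sψ) = HasDom-erase ¬Px dom
    , ⊨FO-cong ψ (Agree-off (λ m → ¬Px (hψ m)) (λ y≢x → sym (erase-≢ s y≢x))) sψ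

  ⋃upd-⟦⟧ : ∀ {P} ψ {x} → ¬ P x → fvFO ψ ⊆ P → ⋃upd (⟦ ψ ⟧ P) x ≐′ ⟦ ψ ⟧ extend P x
  ⋃upd-⟦⟧ {P} ψ {x} ¬Px hψ = ⊆ , ⊇
    where
    ⊆ : ⋃upd (⟦ ψ ⟧ P) x ⊆′ ⟦ ψ ⟧ extend P x
    ⊆ t (d , s , s∈ , t≗) = ⟦⟧-resp-≗ ψ (λ y → sym (t≗ y)) ([↦]-∈⟦⟧ ψ d ¬Px hψ s∈)
    ⊇ : ⟦ ψ ⟧ extend P x ⊆′ ⋃upd (⟦ ψ ⟧ P) x
    ⊇ t t∈@(dom , _) with Is-just⇒≡just (proj₁ (dom x) (inj₂ refl))
    ... | d , tx≡d = d , erase x t , erase-∈⟦⟧ ψ ¬Px hψ t∈ , erase-[↦] tx≡d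

  HasDom-Variant : ∀ {P ns s t} → ns ⊆ P → HasDom P s → Variant ns s t → HasDom P t
  HasDom-Variant {P} {ns} ns⊆P dom (same , defined) y with y ∈? ns
  ... | yes m   = (λ _ → defined y m) , (λ _ → ns⊆P m)
  ... | no y∉ns =
    subst (λ m → (P y → Is-just m) × (Is-just m → P y)) (sym (same y y∉ns)) (dom y)

  Variant⇒≈ : ∀ {a ns s t} → (∀ {y} → y ∈ ns → NonObs a y) → Variant ns s t → t ≈[ a ] s
  Variant⇒≈ nonobs (same , _) y a∈Gy _ = same y (λ m → nonobs m a∈Gy)

  overwrite : List Var → State → State → State
  overwrite ns s′ s y = if does (y ∈? ns) then s′ y else s y

  Variant-overwrite : ∀ {ns s′ s} → (∀ {y} → y ∈ ns → Is-just (s′ y)) →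
                      Variant ns s (overwrite ns s′ s)
  Variant-overwrite {ns} {s′} {s} defined = same , defined′
    where
    same : ∀ y → y ∉ ns → overwrite ns s′ s y ≡ s y
    same y y∉ns rewrite dec-false (y ∈? ns) y∉ns = refl
    defined′ : ∀ y → y ∈ ns → Is-just (overwrite ns s′ s y)
    defined′ y m rewrite dec-true (y ∈? ns) m = defined m

  Agree-overwrite : ∀ {xs ns s′ s} → (∀ {y} → y ∈ xs → y ∉ ns → s′ y ≡ s y) →
                    Agree xs (overwrite ns s′ s) s′
  Agree-overwrite {ns = ns} outside {y} m with y ∈? ns
  ... | yes _   = refl
  ... | no y∉ns = sym (outside m y∉ns)

  ∈-nonobsFilter⁻ : ∀ {a y} xs → y ∈ nonobsFilter a xs → y ∈ xs × NonObs a y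
  ∈-nonobsFilter⁻ {a} xs = ∈-filter⁻ (λ y → ¬? (a ∈ₛ? group y)) {xs = xs}

  ∉-nonobsFilter⇒obs : ∀ {a y xs} → y ∈ xs → y ∉ nonobsFilter a xs → a ∈ₛ group y
  ∉-nonobsFilter⇒obs {a} {y} m y∉ =
    decidable-stable (a ∈ₛ? group y) (λ a∉Gy → y∉ (∈-filter⁺ (λ z → ¬? (a ∈ₛ? group z)) m a∉Gy))

  Correct : (Var → Set) → FO → Form → Set
  Correct P ψ α = ∀ {s} → (⟦ ψ ⟧ P) s → Sat (⟦ ψ ⟧ P) s α ⇔ (s ⊨FO τ ψ α)

  K-correct : ∀ {P} ψ a α → fvFO ψ ⊆ P → fvK α ⊆ P → Correct P ψ α → Correct P ψ (K a α)
  K-correct {P} ψ a α hψ hα IH {s} (dom , _) = mk⇔ fwd bwd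
    where
    L ns : List Var
    L  = fvK α ++ fvFO ψ
    ns = nonobsFilter a L
    ns⊆P : ns ⊆ P
    ns⊆P m = ++⁺-⊆ hα hψ (proj₁ (∈-nonobsFilter⁻ L m))
    fvFO-χ⊆L : fvFO (ψ ⇒ τ ψ α) ⊆ (_∈ L)
    fvFO-χ⊆L = ++⁺-⊆ (∈-++⁺ʳ (fvK α)) (fvFO-τ-⊆ ψ α (∈-++⁺ʳ (fvK α)) ∈-++⁺ˡ)
    fwd : Sat (⟦ ψ ⟧ P) s (K a α) → s ⊨FO τ ψ (K a α)
    fwd h = ∀*-intro ns (ψ ⇒ τ ψ α) λ t v tψ →
      let t∈ : (⟦ ψ ⟧ P) t
          t∈ = HasDom-Variant ns⊆P dom v , tψ
      in to (IH t∈) (h t t∈ (Variant⇒≈ (λ m → proj₂ (∈-nonobsFilter⁻ L m)) v))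
    bwd : s ⊨FO τ ψ (K a α) → Sat (⟦ ψ ⟧ P) s (K a α)
    bwd h s′ s′∈@(dom′ , s′ψ) s′≈s =
      from (IH s′∈) (⊨FO-cong χ (λ m → agree (fvFO-χ⊆L m)) (∀*-elim ns χ h variant) s′ψ)
      where
      χ : FO
      χ = ψ ⇒ τ ψ α
      -- s′ agrees with s on the variables of L that a observes, so overwriting
      -- s by s′ on ns gives a variant of s that agrees with s′ on all of L.
      variant : Variant ns s (overwrite ns s′ s)
      variant = Variant-overwrite (λ m → proj₁ (dom′ _) (ns⊆P m))
      agree : Agree L (overwrite ns s′ s) s′
      agree = Agree-overwrite λ {y} m y∉ns →
        s′≈s y (∉-nonobsFilter⇒obs m y∉ns) (inj₁ (proj₁ (dom′ y) (++⁺-⊆ hα hψ m)))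

  restrict-⟦⟧ : ∀ {P} ψ β → Correct P ψ β →
                (λ t → (⟦ ψ ⟧ P) t × Sat (⟦ ψ ⟧ P) t β) ≐′ ⟦ ψ ∧f τ ψ β ⟧ P
  restrict-⟦⟧ ψ β IH = (λ t ((dom , tψ) , tβ) → dom , tψ , to (IH (dom , tψ)) tβ)
                 , (λ t (dom , tψ , tτβ) → (dom , tψ) , from (IH (dom , tψ)) tτβ)

  announce-correct : ∀ {P} ψ β α → Correct P ψ β → Correct P (ψ ∧f τ ψ β) α →
                     Correct P ψ ([ β ] α)
  announce-correct {P} ψ β α IHβ IHα s∈@(dom , sψ) = mk⇔
    (λ h sτβ → to (IHα (dom , sψ , sτβ)) (Sat-resp-≐′ α restricted (h (from (IHβ s∈) sτβ))))
    (λ h sβ → let sτβ = to (IHβ s∈) sβ in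
      Sat-resp-≐′ α (≐′-sym restricted) (from (IHα (dom , sψ , sτβ)) (h sτβ)))
    where
    restricted : (λ t → (⟦ ψ ⟧ P) t × Sat (⟦ ψ ⟧ P) t β) ≐′ ⟦ ψ ∧f τ ψ β ⟧ P
    restricted = restrict-⟦⟧ ψ β IHβ

  ∀-correct : ∀ {P} ψ x α → ¬ P x → fvFO ψ ⊆ P → Correct (extend P x) ψ α →
              Correct P ψ (∀K x α)
  ∀-correct {P} ψ x α ¬Px hψ IH {s} s∈ = mk⇔
    (λ h c → to (IH (updated c)) (Sat-resp-≐′ α ⋃upd≐ (h c)))
    (λ h c → Sat-resp-≐′ α (≐′-sym ⋃upd≐) (from (IH (updated c)) (h c)))
    where
    ⋃upd≐ : ⋃upd (⟦ ψ ⟧ P) x ≐′ ⟦ ψ ⟧ extend P x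
    ⋃upd≐ = ⋃upd-⟦⟧ ψ ¬Px hψ
    updated : ∀ c → (⟦ ψ ⟧ extend P x) (s [ x ↦ c ])
    updated c = [↦]-∈⟦⟧ ψ c ¬Px hψ s∈

  Sat⇔τ : ∀ {P} ψ α → fvFO ψ ⊆ P → fvK α ⊆ P → BoundFresh P α → Correct P ψ α
  Sat⇔τ ψ (atom π)  hψ hα _ _ = ⇔-id _
  Sat⇔τ ψ (α ∧K β)  hψ hα (bα , bβ) s∈ =
    Sat⇔τ ψ α hψ (++⁻ˡ-⊆ (fvK β) hα) bα s∈ ×-⇔ Sat⇔τ ψ β hψ (++⁻ʳ-⊆ (fvK α) hα) bβ s∈
  Sat⇔τ ψ (¬K α)    hψ hα bα s∈ = ¬-cong-⇔ (Sat⇔τ ψ α hψ hα bα s∈)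
  Sat⇔τ ψ (K a α)   hψ hα bα = K-correct ψ a α hψ hα (Sat⇔τ ψ α hψ hα bα)
  Sat⇔τ {P} ψ ([ β ] α) hψ hα (bβ , bα) =
    announce-correct ψ β α (Sat⇔τ ψ β hψ hβ bβ)
      (Sat⇔τ (ψ ∧f τ ψ β) α (++⁺-⊆ hψ (fvFO-τ-⊆ ψ β hψ hβ)) (++⁻ʳ-⊆ (fvK β) hα) bα)
    where
    hβ : fvK β ⊆ P
    hβ = ++⁻ˡ-⊆ (fvK α) hα
  Sat⇔τ ψ (∀K x α)  hψ hα (¬Px , bα) =
    ∀-correct ψ x α ¬Px hψ (Sat⇔τ ψ α (λ m → inj₁ (hψ m)) (remove⁻-⊆ (fvK α) hα) bα)

mainTheorem4 : (S : Setting) → let open Logic S in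
    (p : Setting.Var S → Set) → Σ (Setting.Var S) p →
    (φ : FO) (α : Form) (s : State) →
    (⟦ φ ⟧ p) s → fvFO φ ⊆ p → fvK α ⊆ p → BoundFresh p α →
    Sat (⟦ φ ⟧ p) s α ⇔ (s ⊨FO τ φ α)
mainTheorem4 S p _ φ α s s∈ hφ hα hb = Sat⇔τ S φ α hφ hα hb s∈
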